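{- Let $(M,\le_M)$ and $(L,\le_L)$ be partially ordered sets, and let $\boxplus:2^L\to L$, $\boxminus:L\times L\to L$ and $\circledcirc:L\to L$ be operations such that the following four axioms hold: (A1) for every $S\subseteq M$ there is $\breve S\subseteq S$ such that for every $s\in S$ there is $\breve s\in\breve S$ with $\breve s\le_M s$, and no two elements $\breve s,\breve s'\in\breve S$ satisfy $\breve s<_M\breve s'$; (A2) for all $L',L''\subseteq L$ and all $x\in L'$: $x\le_L\boxplus(L')$, and $L'\subseteq L''$ implies $\boxplus(L')\le_L\boxplus(L'')$; (A3) for all $l,l'\in L$: $\boxminus(l,\circledcirc(l))=l$, and $l\le_L l'$ implies $\circledcirc(l)\le_L\circledcirc(l')$; (A4) for all $l,l'\in L$ with $l\le_L l'$ there exists $l''\in L$ with $\boxminus(l',l'')=l$ and $\circledcirc(l')\le_L l''$. Suppose moreover that there is an integer $D\ge 0$ such that every increasing chain in $(M,\le_M)$ has length at most $D$. Then for every function $\psi:M\to L$ there exist an integer $k$ with $0\le k\le D$ and monotonic functions $\varphi_1,\dots,\varphi_{k+1}:M\to L$ such that for all $x\in M$, $$\psi(x)=\boxminus\big(\varphi_1(x),\boxminus(\varphi_2(x),\dots\boxminus(\varphi_k(x),\varphi_{k+1}(x))\dots)\big)$$ (for $k=0$ this means $\psi=\varphi_1$); in particular the number of occurrences of $\boxminus$ in this representation is at most $D$.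
   Context: A function $\nu:M\to L$ is monotonic if $m\le_M m'$ implies $\nu(m)\le_L\nu(m')$. An increasing chain $x_0<_M x_1<_M\dots<_M x_r$ has length $r$ (the number of strict steps). The nested expression is evaluated pointwise in $x$. -}

module Defs where

open import Level using (0ℓ)
open import Data.Nat using (ℕ; zero; suc; _≤_)
open import Data.Fin using (Fin; zero; suc; inject₁)
open import Data.Product using (Σ; _×_; _,_)
open import Relation.Nullary using (¬_)
open import Relation.Unary using (Pred; _⊆_)
open import Relation.Binary using (Rel; IsPartialOrder)
open import Relation.Binary.PropositionalEquality using (_≡_; _≢_)

Strict : {A : Set} → Rel A 0ℓ → Rel A 0ℓ
Strict _≤_ x y = (x ≤ y) × (x ≢ y)

A1 : {M : Set} → Rel M 0ℓ → Set₁
A1 {M} _≤_ =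
  (S : Pred M 0ℓ) → Σ (Pred M 0ℓ) λ S̆ →
      (S̆ ⊆ S)
    × ((s : M) → S s → Σ M λ t → S̆ t × (t ≤ s))
    × ((t t′ : M) → S̆ t → S̆ t′ → ¬ Strict _≤_ t t′)

A2 : {L : Set} → Rel L 0ℓ → (Pred L 0ℓ → L) → Set₁
A2 {L} _≤_ ⊞ =
    ((L′ : Pred L 0ℓ) (x : L) → L′ x → x ≤ ⊞ L′)
  × ((L′ L″ : Pred L 0ℓ) → L′ ⊆ L″ → ⊞ L′ ≤ ⊞ L″)

A3 : {L : Set} → Rel L 0ℓ → (L → L → L) → (L → L) → Set
A3 {L} _≤_ ⊟ ⊚ =
    ((l : L) → ⊟ l (⊚ l) ≡ l)
  × ((l l′ : L) → l ≤ l′ → ⊚ l ≤ ⊚ l′)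

A4 : {L : Set} → Rel L 0ℓ → (L → L → L) → (L → L) → Set
A4 {L} _≤_ ⊟ ⊚ =
  (l l′ : L) → l ≤ l′ → Σ L λ l″ → (⊟ l′ l″ ≡ l) × (⊚ l′ ≤ l″)

-- every increasing chain x₀ < x₁ < … < x_r (length r) has r ≤ D
ChainsBoundedBy : {M : Set} → Rel M 0ℓ → ℕ → Set
ChainsBoundedBy {M} _⊑_ D =
  (r : ℕ) (x : Fin (suc r) → M) →
  ((i : Fin r) → Strict _⊑_ (x (inject₁ i)) (x (suc i))) → r ≤ D

Monotone : {M L : Set} → Rel M 0ℓ → Rel L 0ℓ → (M → L) → Set
Monotone {M} _≤M_ _≤L_ f = (m m′ : M) → m ≤M m′ → f m ≤L f m′

-- nested ⊟(v₁, ⊟(v₂, … ⊟(v_k, v_{k+1})…)); for k = 0 it is v₁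
-- (indices shifted to start at 0: v zero = v₁)
nest : {L : Set} → (L → L → L) → (k : ℕ) → (Fin (suc k) → L) → L
nest ⊟ zero    v = v zero
nest ⊟ (suc k) v = ⊟ (v zero) (nest ⊟ k (λ i → v (suc i)))

module Submission where

-- Peel M into layers: layer j is the antichain given by (A1) for the set of
-- elements not in layers 0, …, j-1. Each remaining element sits on top of a
-- chain through all earlier layers, so after D peelings only maximal elements
-- are left. Call ψ monotone on the first j layers if ψ x ≤ ψ y whenever x ≤ y
-- and x lies in one of them; every ψ has this property for j = 0 and for
-- j = D it is plain monotonicity. One peeling step writes ψ = ⊟(φ, ψ′) with φ
-- monotone and ψ′ monotone on one more layer: on layers 0, …, j take φ = ψ and
-- ψ′ = ⊚ ψ (A3); elsewhere take φ x = ⊞ {ψ y ∣ y ≤ x}, which dominates ψ x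
-- (A2), and let (A4) supply ψ′ x ≥ ⊚ (φ x).

open import Defs
open import Level using (0ℓ)
open import Axiom.ExcludedMiddle using (ExcludedMiddle)
open import Data.Nat using (ℕ; zero; suc; _≤_; _+_)
open import Data.Nat.Properties using (+-suc; +-identityʳ; m+1+n≰m; ≤-refl)
open import Data.Fin using (Fin; zero; suc; inject₁)
open import Data.Vec.Functional using ([]; _∷_)
open import Data.Product using (Σ; _×_; _,_; proj₁; proj₂)
open import Data.Unit using (⊤; tt)
open import Data.Empty using (⊥-elim)
open import Function using (_∘_)
open import Relation.Nullary using (Dec; yes; no; ¬_)
open import Relation.Nullary.Decidable using (decidable-stable)
open import Relation.Unary using (Pred; _⊆_)
open import Relation.Binary using (Rel; IsPartialOrder)
open import Relation.Binary.PropositionalEquality using (_≡_; refl; sym; trans; subst; cong)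

Chain : {M : Set} → Rel M 0ℓ → (r : ℕ) → (Fin (suc r) → M) → Set
Chain _⊑_ r c = (i : Fin r) → Strict _⊑_ (c (inject₁ i)) (c (suc i))

≤∧¬<⇒≡ : ExcludedMiddle 0ℓ → {M : Set} (_⊑_ : Rel M 0ℓ) {x y : M} →
  x ⊑ y → ¬ Strict _⊑_ x y → x ≡ y
≤∧¬<⇒≡ em _ x⊑y x⋢y = decidable-stable em λ x≢y → x⋢y (x⊑y , x≢y)

module _ {A L : Set} (⊟ : L → L → L)
  (Q : (A → L) → Set) (P : ℕ → (A → L) → Set)
  (split : ∀ {j} ψ → P j ψ → Σ (A → L) λ φ → Σ (A → L) λ ψ′ →
             Q φ × P (suc j) ψ′ × ((x : A) → ψ x ≡ ⊟ (φ x) (ψ′ x))) where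

  nest-decompose : ∀ n {j} ψ → P j ψ → (∀ {ψ′} → P (n + j) ψ′ → Q ψ′) →
    Σ (Fin (suc n) → A → L) λ φ →
      ((i : Fin (suc n)) → Q (φ i)) × ((x : A) → ψ x ≡ nest ⊟ n (λ i → φ i x))
  nest-decompose zero    ψ Pψ final = (λ _ → ψ) , (λ _ → final Pψ) , (λ _ → refl)
  nest-decompose (suc n) {j} ψ Pψ final with split ψ Pψ
  ... | φ₀ , ψ′ , Qφ₀ , Pψ′ , ψ≡
    with nest-decompose n ψ′ Pψ′ (λ {ψ″} → final ∘ subst (λ m → P m ψ″) (+-suc n j))
  ... | φ , Qφ , ψ′≡ =
    φ₀ ∷ φ , Q-all , λ x → trans (ψ≡ x) (cong (⊟ (φ₀ x)) (ψ′≡ x))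
    where
    Q-all : (i : Fin (suc (suc n))) → Q ((φ₀ ∷ φ) i)
    Q-all zero    = Qφ₀
    Q-all (suc i) = Qφ i

module Layers {M : Set} {_≤M_ : Rel M 0ℓ} (em : ExcludedMiddle 0ℓ)
  (po : IsPartialOrder _≡_ _≤M_) (a1 : A1 _≤M_) where

  private module PO = IsPartialOrder po

  Upper : ℕ → Pred M 0ℓ
  Bottom : ℕ → Pred M 0ℓ
  Upper zero    _ = ⊤
  Upper (suc j) x = Upper j x × ¬ Bottom j x
  Bottom j = proj₁ (a1 (Upper j))

  Bottom⊆Upper : ∀ j → Bottom j ⊆ Upper j
  Bottom⊆Upper j = proj₁ (proj₂ (a1 (Upper j)))

  Bottom-below : ∀ j {x} → Upper j x → Σ M λ t → Bottom j t × (t ≤M x)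
  Bottom-below j {x} = proj₁ (proj₂ (proj₂ (a1 (Upper j)))) x

  Bottom-≤⇒≡ : ∀ j {x y} → Bottom j x → Bottom j y → x ≤M y → x ≡ y
  Bottom-≤⇒≡ j {x} {y} x∈B y∈B x≤y =
    ≤∧¬<⇒≡ em _≤M_ x≤y (proj₂ (proj₂ (proj₂ (a1 (Upper j)))) x y x∈B y∈B)

  Upper∖Upper-suc⊆Bottom : ∀ j {x} → Upper j x → ¬ Upper (suc j) x → Bottom j x
  Upper∖Upper-suc⊆Bottom j x∈U x∉U′ =
    decidable-stable em λ x∉B → x∉U′ (x∈U , x∉B)

  Upper-upward : ∀ j {x y} → Upper j x → x ≤M y → Upper j y
  Upper-upward zero    _ _ = tt
  Upper-upward (suc j) {x} {y} (x∈U , x∉B) x≤y = Upper-upward j x∈U x≤y , y∉B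
    where
    y∉B : ¬ Bottom j y
    y∉B y∈B with Bottom-below j x∈U
    ... | t , t∈B , t≤x with Bottom-≤⇒≡ j t∈B y∈B (PO.trans t≤x x≤y)
    ... | refl = x∉B (subst (Bottom j) (PO.antisym t≤x x≤y) t∈B)

  module _ {D : ℕ} (bounded : ChainsBoundedBy _≤M_ D) where

    Upper-chain-bound : ∀ j r (c : Fin (suc r) → M) →
      Upper j (c zero) → Chain _≤M_ r c → j + r ≤ D
    Upper-chain-bound zero    r c _ c-chain = bounded r c c-chain
    Upper-chain-bound (suc j) r c (c₀∈U , c₀∉B) c-chain with Bottom-below j c₀∈U
    ... | t , t∈B , t≤c₀ = subst (_≤ D) (+-suc j r)
            (Upper-chain-bound j (suc r) (t ∷ c) (Bottom⊆Upper j t∈B) tc-chain)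
      where
      tc-chain : Chain _≤M_ (suc r) (t ∷ c)
      tc-chain zero    = t≤c₀ , λ { refl → c₀∉B t∈B }
      tc-chain (suc i) = c-chain i

    Upper-maximal : ∀ {x y} → Upper D x → x ≤M y → x ≡ y
    Upper-maximal {x} {y} x∈U x≤y = ≤∧¬<⇒≡ em _≤M_ x≤y λ x<y →
      m+1+n≰m D (Upper-chain-bound D 1 (x ∷ y ∷ []) x∈U λ { zero → x<y })

module Peeling {M L : Set} {_≤M_ : Rel M 0ℓ} {_≤L_ : Rel L 0ℓ}
  (em : ExcludedMiddle 0ℓ)
  (poM : IsPartialOrder _≡_ _≤M_) (poL : IsPartialOrder _≡_ _≤L_)
  {⊞ : Pred L 0ℓ → L} {⊟ : L → L → L} {⊚ : L → L}
  (a1 : A1 _≤M_) (a2 : A2 _≤L_ ⊞) (a3 : A3 _≤L_ ⊟ ⊚) (a4 : A4 _≤L_ ⊟ ⊚) where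

  open Layers em poM a1
  private
    module PM = IsPartialOrder poM
    module PL = IsPartialOrder poL

  MonotoneOnLayers : ℕ → (M → L) → Set
  MonotoneOnLayers j ψ = ∀ {x y} → ¬ Upper j x → x ≤M y → ψ x ≤L ψ y

  MonotoneOnLayers-zero : ∀ ψ → MonotoneOnLayers 0 ψ
  MonotoneOnLayers-zero ψ x∉U _ = ⊥-elim (x∉U tt)

  MonotoneOnLayers⇒Monotone : ∀ {D} → ChainsBoundedBy _≤M_ D →
    ∀ {ψ} → MonotoneOnLayers D ψ → Monotone _≤M_ _≤L_ ψ
  MonotoneOnLayers⇒Monotone {D} bounded {ψ} ψ-mono x y x≤y with em {Upper D x}
  ... | yes x∈U = PL.reflexive (cong ψ (Upper-maximal bounded x∈U x≤y))
  ... | no  x∉U = ψ-mono x∉U x≤y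

  module Step (j : ℕ) {ψ : M → L} (ψ-mono : MonotoneOnLayers j ψ) where

    ψ[↓_] : M → Pred L 0ℓ
    ψ[↓ x ] l = Σ M λ y → (y ≤M x) × (ψ y ≡ l)

    ψ≤⊞ψ[↓] : ∀ {x y} → x ≤M y → ψ x ≤L ⊞ ψ[↓ y ]
    ψ≤⊞ψ[↓] {x} x≤y = proj₁ a2 _ (ψ x) (x , x≤y , refl)

    ⊞ψ[↓]-mono : ∀ {x y} → x ≤M y → ⊞ ψ[↓ x ] ≤L ⊞ ψ[↓ y ]
    ⊞ψ[↓]-mono x≤y =
      proj₂ a2 _ _ λ { (z , z≤x , refl) → z , PM.trans z≤x x≤y , refl }

    complement : ∀ x → Σ L λ l → (⊟ (⊞ ψ[↓ x ]) l ≡ ψ x) × (⊚ (⊞ ψ[↓ x ]) ≤L l)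
    complement x = a4 (ψ x) (⊞ ψ[↓ x ]) (ψ≤⊞ψ[↓] PM.refl)

    ψ-mono-within-layers : ∀ {x y} → ¬ Upper (suc j) x → ¬ Upper (suc j) y →
      x ≤M y → ψ x ≤L ψ y
    ψ-mono-within-layers {x} {y} x∉U′ y∉U′ x≤y with em {Upper j x}
    ... | no  x∉U = ψ-mono x∉U x≤y
    ... | yes x∈U = PL.reflexive (cong ψ (Bottom-≤⇒≡ j x∈B y∈B x≤y))
      where
      x∈B = Upper∖Upper-suc⊆Bottom j x∈U x∉U′
      y∈B = Upper∖Upper-suc⊆Bottom j (Upper-upward j x∈U x≤y) y∉U′

    head tail : ∀ x → Dec (Upper (suc j) x) → L
    head x (yes _) = ⊞ ψ[↓ x ]
    head x (no  _) = ψ x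
    tail x (yes _) = proj₁ (complement x)
    tail x (no  _) = ⊚ (ψ x)

    head-mono : ∀ {x y} dx dy → x ≤M y → head x dx ≤L head y dy
    head-mono (yes _)   (yes _)   x≤y = ⊞ψ[↓]-mono x≤y
    head-mono (yes x∈U) (no  y∉U) x≤y = ⊥-elim (y∉U (Upper-upward (suc j) x∈U x≤y))
    head-mono (no  _)   (yes _)   x≤y = ψ≤⊞ψ[↓] x≤y
    head-mono (no  x∉U) (no  y∉U) x≤y = ψ-mono-within-layers x∉U y∉U x≤y

    tail-mono : ∀ {x y} dx dy → ¬ Upper (suc j) x → x ≤M y → tail x dx ≤L tail y dy
    tail-mono (yes x∈U) _ x∉U _ = ⊥-elim (x∉U x∈U)
    tail-mono (no x∉U) (no y∉U) _ x≤y = proj₂ a3 _ _ (ψ-mono-within-layers x∉U y∉U x≤y)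
    tail-mono {y = y} (no _) (yes _) _ x≤y =
      PL.trans (proj₂ a3 _ _ (ψ≤⊞ψ[↓] x≤y)) (proj₂ (proj₂ (complement y)))

    ψ≡⊟head-tail : ∀ x dx → ψ x ≡ ⊟ (head x dx) (tail x dx)
    ψ≡⊟head-tail x (yes _) = sym (proj₁ (proj₂ (complement x)))
    ψ≡⊟head-tail x (no  _) = sym (proj₁ a3 (ψ x))

  peel : ∀ {j} ψ → MonotoneOnLayers j ψ →
    Σ (M → L) λ φ → Σ (M → L) λ ψ′ →
      Monotone _≤M_ _≤L_ φ × MonotoneOnLayers (suc j) ψ′ ×
      ((x : M) → ψ x ≡ ⊟ (φ x) (ψ′ x))
  peel {j} ψ ψ-mono =
      (λ x → head x em) , (λ x → tail x em)
    , (λ x y → head-mono em em) , (λ x∉U → tail-mono em em x∉U)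
    , (λ x → ψ≡⊟head-tail x em)
    where open Step j ψ-mono

theorem1 : ExcludedMiddle 0ℓ →
    (M L : Set) (_≤M_ : Rel M 0ℓ) (_≤L_ : Rel L 0ℓ) →
    IsPartialOrder _≡_ _≤M_ → IsPartialOrder _≡_ _≤L_ →
    (⊞ : Pred L 0ℓ → L) (⊟ : L → L → L) (⊚ : L → L) →
    A1 _≤M_ → A2 _≤L_ ⊞ → A3 _≤L_ ⊟ ⊚ → A4 _≤L_ ⊟ ⊚ →
    (D : ℕ) → ChainsBoundedBy _≤M_ D →
    (ψ : M → L) →
    Σ ℕ λ k → (k ≤ D) × Σ (Fin (suc k) → M → L) λ φ →
      ((i : Fin (suc k)) → Monotone _≤M_ _≤L_ (φ i))
      × ((x : M) → ψ x ≡ nest ⊟ k (λ i → φ i x))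
theorem1 em M L _≤M_ _≤L_ poM poL ⊞ ⊟ ⊚ a1 a2 a3 a4 D bounded ψ =
  D , ≤-refl ,
  nest-decompose ⊟ (Monotone _≤M_ _≤L_) MonotoneOnLayers peel
    D ψ (MonotoneOnLayers-zero ψ) monotone-on-D-layers
  where
  open Peeling em poM poL a1 a2 a3 a4
  monotone-on-D-layers : ∀ {φ} → MonotoneOnLayers (D + 0) φ → Monotone _≤M_ _≤L_ φ
  monotone-on-D-layers {φ} =
    MonotoneOnLayers⇒Monotone bounded ∘ subst (λ m → MonotoneOnLayers m φ) (+-identityʳ D)
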